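{- There exists a function $g\colon\mathbb N\to\mathbb N$ which is $\langle\mathbb N;+\rangle$-congruence preserving but is not monotone, and hence is not $\langle\mathbb N;+\rangle$-stable-preorder preserving.
   Context: An $\langle\mathbb N;+\rangle$-congruence is an equivalence relation $\sim$ on $\mathbb N$ with $x\sim y, x'\sim y'\Rightarrow x+x'\sim y+y'$; a stable preorder is a reflexive transitive relation with the same compatibility property. $g$ preserves a relation $\rho$ if $x\rho y$ implies $g(x)\rho g(y)$; $g$ is congruence (resp. stable-preorder) preserving if it preserves all congruences (resp. stable preorders). -}

module Defs where

open import Data.Nat using (ℕ; _+_; _≤_)
open import Relation.Binary.Core using (Rel)
open import Relation.Binary.Structures using (IsEquivalence; IsPreorder)
open import Relation.Binary.PropositionalEquality using (_≡_)
open import Level using (0ℓ)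

Compatible : Rel ℕ 0ℓ → Set
Compatible ρ = ∀ {x y x' y'} → ρ x y → ρ x' y' → ρ (x + x') (y + y')

IsCongruence : Rel ℕ 0ℓ → Set
IsCongruence ρ = IsEquivalence ρ × Compatible ρ
  where open import Data.Product using (_×_)

IsStablePreorder : Rel ℕ 0ℓ → Set
IsStablePreorder ρ = IsPreorder _≡_ ρ × Compatible ρ
  where open import Data.Product using (_×_)

Preserves : (ℕ → ℕ) → Rel ℕ 0ℓ → Set
Preserves g ρ = ∀ {x y} → ρ x y → ρ (g x) (g y)

CongruencePreserving : (ℕ → ℕ) → Set₁
CongruencePreserving g = (ρ : Rel ℕ 0ℓ) → IsCongruence ρ → Preserves g ρ

StablePreorderPreserving : (ℕ → ℕ) → Set₁
StablePreorderPreserving g = (ρ : Rel ℕ 0ℓ) → IsStablePreorder ρ → Preserves g ρ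

Monotone : (ℕ → ℕ) → Set
Monotone g = ∀ {x y} → x ≤ y → g x ≤ g y

{-# OPTIONS --safe #-}
-- The witness is g x = (x − 1)² + 1, computed in ℤ. Being an integer polynomial, it satisfies
-- g (x + d) ≡ g x (mod d), and g x ≥ x for every x. A congruence relating x to x + d
-- relates z to z + m d for every z ≥ x and every m, so it relates g x to g (x + d).
-- Yet g 0 = 2 > 1 = g 1, while ≤ is itself a stable preorder.
module Submission where

open import Defs
open import Data.Nat using (ℕ; zero; suc; _+_; _*_; _≤_; z≤n; s≤s)
open import Data.Nat.Properties
  using (≤-total; ≤-trans; m≤m+n; m≤m*n; n<1+n; <⇒≱; +-assoc; +-comm; +-identityʳ;
         ≤-isPreorder; +-mono-≤; m≤n⇒∃[o]m+o≡n)
open import Data.Nat.Tactic.RingSolver using (solve-∀)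
open import Data.Product using (Σ; _×_; _,_; proj₁; proj₂)
open import Data.Sum using (inj₁; inj₂)
open import Function using (_∘_)
open import Relation.Binary.Core using (Rel)
open import Relation.Binary.Structures using (IsEquivalence)
open import Relation.Binary.PropositionalEquality
  using (_≡_; refl; cong; subst; subst₂; module ≡-Reasoning)
import Relation.Binary.PropositionalEquality as ≡
open import Relation.Nullary using (¬_)
open import Level using (0ℓ)

data SameResidueAbove (x d : ℕ) (u v : ℕ) : Set where
  residues : ∀ {z} m n → x ≤ z → u ≡ z + m * d → v ≡ z + n * d → SameResidueAbove x d u v

module CongruenceProperties {_≈_ : Rel ℕ 0ℓ} (isCongruence : IsCongruence _≈_) where

  open IsEquivalence (proj₁ isCongruence) public
    renaming (refl to ≈-refl; sym to ≈-sym; trans to ≈-trans)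

  private
    compatible : Compatible _≈_
    compatible = proj₂ isCongruence

  x≈x+d⇒z≈z+d : ∀ {x d z} → x ≈ (x + d) → x ≤ z → z ≈ (z + d)
  x≈x+d⇒z≈z+d {x} {d} x≈x+d x≤z with m≤n⇒∃[o]m+o≡n x≤z
  ... | e , refl = subst₂ _≈_ (+-comm e x) (cong (_+ d) (+-comm e x))
    (subst ((e + x) ≈_) (≡.sym (+-assoc e x d)) (compatible (≈-refl {e}) x≈x+d))

  x≈x+d⇒z≈z+m*d : ∀ {x d z} → x ≈ (x + d) → x ≤ z → ∀ m → z ≈ (z + m * d)
  x≈x+d⇒z≈z+m*d {z = z} _ _ zero = subst (z ≈_) (≡.sym (+-identityʳ z)) ≈-refl
  x≈x+d⇒z≈z+m*d {x} {d} {z} x≈x+d x≤z (suc m) =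
    ≈-trans (x≈x+d⇒z≈z+m*d x≈x+d x≤z m)
      (subst ((z + m * d) ≈_) z+m*d+d≡z+[1+m]*d
        (x≈x+d⇒z≈z+d x≈x+d (≤-trans x≤z (m≤m+n z (m * d)))))
    where
    open ≡-Reasoning
    z+m*d+d≡z+[1+m]*d : z + m * d + d ≡ z + suc m * d
    z+m*d+d≡z+[1+m]*d = begin
      z + m * d + d   ≡⟨ +-assoc z (m * d) d ⟩
      z + (m * d + d) ≡⟨ cong (z +_) (+-comm (m * d) d) ⟩
      z + suc m * d   ∎

  sameResidueAbove⇒≈ : ∀ {x d u v} → x ≈ (x + d) → SameResidueAbove x d u v → u ≈ v
  sameResidueAbove⇒≈ x≈x+d (residues m n x≤z refl refl) =
    ≈-trans (≈-sym (x≈x+d⇒z≈z+m*d x≈x+d x≤z m)) (x≈x+d⇒z≈z+m*d x≈x+d x≤z n)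

sameResidueAbove⇒congruencePreserving :
  ∀ {g} → (∀ x d → SameResidueAbove x d (g x) (g (x + d))) → CongruencePreserving g
sameResidueAbove⇒congruencePreserving {g} sameResidue _≈_ isCongruence = preserves
  where
  open CongruenceProperties isCongruence
  preserves : Preserves g _≈_
  preserves {x} {y} x≈y with ≤-total x y
  ... | inj₁ x≤y with m≤n⇒∃[o]m+o≡n x≤y
  ...   | d , refl = sameResidueAbove⇒≈ x≈y (sameResidue x d)
  preserves {x} {y} x≈y | inj₂ y≤x with m≤n⇒∃[o]m+o≡n y≤x
  ...   | d , refl = ≈-sym (sameResidueAbove⇒≈ (≈-sym x≈y) (sameResidue y d))

≤-isStablePreorder : IsStablePreorder _≤_
≤-isStablePreorder = ≤-isPreorder , +-mono-≤

stablePreorderPreserving⇒monotone : ∀ {g} → StablePreorderPreserving g → Monotone g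
stablePreorderPreserving⇒monotone preserving = preserving _≤_ ≤-isStablePreorder

g : ℕ → ℕ
g zero    = 2
g (suc n) = suc (n * n)

n≤n*n : ∀ n → n ≤ n * n
n≤n*n zero    = z≤n
n≤n*n (suc n) = m≤m*n (suc n) (suc n)

g-sameResidueAbove : ∀ x d → SameResidueAbove x d (g x) (g (x + d))
g-sameResidueAbove zero    zero          = residues 0 0 z≤n refl refl
g-sameResidueAbove zero    (suc zero)    = residues 1 0 z≤n refl refl
g-sameResidueAbove zero    (suc (suc k)) = residues 0 k z≤n refl (square k)
  where
  square : ∀ k → suc (suc k * suc k) ≡ 2 + k * suc (suc k)
  square = solve-∀
g-sameResidueAbove (suc a) d = residues 0 (a + a + d) (s≤s (n≤n*n a)) (≡.sym (+-identityʳ _)) (square a d)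
  where
  square : ∀ a d → suc ((a + d) * (a + d)) ≡ suc (a * a) + (a + a + d) * d
  square = solve-∀

g-congruencePreserving : CongruencePreserving g
g-congruencePreserving = sameResidueAbove⇒congruencePreserving g-sameResidueAbove

g-not-monotone : ¬ Monotone g
g-not-monotone monotone = <⇒≱ (n<1+n 1) (monotone {0} {1} z≤n)

proposition3p12 : Σ (ℕ → ℕ) (λ g → CongruencePreserving g × ¬ Monotone g × ¬ StablePreorderPreserving g)
proposition3p12 =
  g , g-congruencePreserving , g-not-monotone , g-not-monotone ∘ stablePreorderPreserving⇒monotone
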